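{- Let $n \ge 2$, $V=\{1,\dots,n\}$, and let $\tau : V \to \{1,\dots,n\}$ be a bijection. Let $G_n=(V,E)$ be the graph obtained by inserting the vertices in increasing order of $\tau$, where each newly inserted vertex $x$ is joined by an undirected edge to the largest $y<x$ with $\tau(y)<\tau(x)$ (if any) and to the smallest $y>x$ with $\tau(y)<\tau(x)$ (if any). Then for every $1 \le i < n$, the edge $\{i,i+1\}$ belongs to $E$.
   Context: In the paper $\tau$ is a uniformly random permutation (insertion times); the statement holds for every fixed bijection $\tau$. -}

module Defs where

open import Data.Nat using (ℕ)
open import Data.Fin using (Fin; _<_)
open import Data.Sum using (_⊎_)
open import Data.Product using (_×_)
open import Relation.Nullary using (¬_)
open import Function.Bundles using (_⤖_; Bijection)

-- Vertices V = {1,…,n} are represented by Fin n (vertex k+1 ↦ k);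
-- this shift preserves the order, so "largest y < x" etc. are unchanged.
-- τ : V → {1,…,n} is a bijection Fin n ⤖ Fin n (insertion times, shifted by 1).

module _ {n : ℕ} (τ : Fin n ⤖ Fin n) where
  private
    t : Fin n → Fin n
    t = Bijection.to τ

  -- When x is inserted, the already inserted vertices are exactly the y with τ y < τ x.
  -- y is the largest y < x with τ y < τ x
  LeftLink : Fin n → Fin n → Set
  LeftLink x y = (y < x) × (t y < t x) ×
                 (∀ (z : Fin n) → y < z → z < x → ¬ (t z < t x))

  RightLink : Fin n → Fin n → Set
  RightLink x y = (x < y) × (t y < t x) ×
                  (∀ (z : Fin n) → x < z → z < y → ¬ (t z < t x))

  Joins : Fin n → Fin n → Set
  Joins x y = LeftLink x y ⊎ RightLink x y

  Edge : Fin n → Fin n → Set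
  Edge u v = Joins u v ⊎ Joins v u

{-# OPTIONS --safe #-}
-- Consecutive vertices i, i+1 have no vertex strictly between them, so whichever
-- of the two is inserted later sees the other as its nearest earlier neighbour on
-- that side; the insertion times differ because τ is injective.
module Submission where

open import Defs
open import Data.Nat using (ℕ; _≤_; suc)
open import Data.Fin using (Fin; toℕ; _<_)
open import Data.Fin.Properties using (<-cmp; <-irrefl)
import Data.Nat.Properties as ℕ
open import Data.Product using (_,_)
open import Data.Sum using (inj₁; inj₂)
open import Function.Bundles using (_⤖_; Bijection)
open import Relation.Binary.Definitions using (tri<; tri≈; tri>)
open import Relation.Binary.PropositionalEquality using (_≡_; _≢_; sym; subst)
open import Relation.Nullary using (¬_; contradiction)

module _ {n : ℕ} {i j : Fin n} (j≡1+i : toℕ j ≡ suc (toℕ i)) where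

  consecutive⇒< : i < j
  consecutive⇒< = subst (suc (toℕ i) ≤_) (sym j≡1+i) ℕ.≤-refl

  consecutive⇒≢ : i ≢ j
  consecutive⇒≢ i≡j = <-irrefl i≡j consecutive⇒<

  consecutive⇒nothing-between : ∀ (z : Fin n) → i < z → ¬ (z < j)
  consecutive⇒nothing-between z i<z z<j =
    ℕ.<⇒≱ i<z (ℕ.≤-pred (subst (suc (toℕ z) ≤_) j≡1+i z<j))

  module _ (τ : Fin n ⤖ Fin n) where
    open Bijection τ using (to; injective)

    consecutive-leftLink : to i < to j → LeftLink τ j i
    consecutive-leftLink τi<τj = consecutive⇒< , τi<τj ,
      λ z i<z z<j _ → consecutive⇒nothing-between z i<z z<j

    consecutive-rightLink : to j < to i → RightLink τ i j
    consecutive-rightLink τj<τi = consecutive⇒< , τj<τi ,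
      λ z i<z z<j _ → consecutive⇒nothing-between z i<z z<j

    consecutive-edge : Edge τ i j
    consecutive-edge with <-cmp (to i) (to j)
    ... | tri< τi<τj _ _ = inj₂ (inj₁ (consecutive-leftLink τi<τj))
    ... | tri≈ _ τi≡τj _ = contradiction (injective τi≡τj) consecutive⇒≢
    ... | tri> _ _ τj<τi = inj₁ (inj₂ (consecutive-rightLink τj<τi))

-- The bound 2 ≤ n only guarantees that some consecutive pair exists.
corollary3p2 : (n : ℕ) → 2 ≤ n → (τ : Fin n ⤖ Fin n) →
    (i j : Fin n) → toℕ j ≡ suc (toℕ i) → Edge τ i j
corollary3p2 n _ τ i j j≡1+i = consecutive-edge j≡1+i τ
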